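{- Let $n$ be a positive integer, $c,u\in\mathbb{Q}\setminus\{0\}$ and $d,v\in\mathbb{Q}$. Then the polynomial $E_n(cx+d)$ is not of the form $ux^q+v$ with $q\ge 3$, and it is not of the form $uD_k(x,a)+v$ with $k>4$ and $a\in\mathbb{Q}\setminus\{0\}$.
   Context: $E_n(x)$ is the $n$-th Euler polynomial, defined by $\sum_{n=0}^{\infty}E_n(x)\frac{t^n}{n!}=\frac{2\exp(tx)}{\exp(t)+1}$. $D_k(x,a)$ is the $k$-th Dickson polynomial with parameter $a$, given by $D_k(x,a)=\sum_{i=0}^{\lfloor k/2\rfloor}\frac{k}{k-i}\binom{k-i}{i}(-a)^i x^{k-2i}$, equivalently defined by $D_k\left(z+\frac{a}{z},a\right)=z^k+\left(\frac{a}{z}\right)^k$. -}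

module Defs where

open import Data.Nat as ℕ using (ℕ; zero; suc; ⌊_/2⌋)
open import Data.Nat.Combinatorics using (_C_)
open import Data.Integer using (+_)
open import Data.Rational using (ℚ; 0ℚ; 1ℚ; ½; _+_; _*_; _-_; -_; _/_)
open import Data.List using (List; []; _∷_; foldr; map; zipWith; downFrom; upTo)

infixr 8 _^ℚ_
_^ℚ_ : ℚ → ℕ → ℚ
x ^ℚ zero  = 1ℚ
x ^ℚ suc n = x * (x ^ℚ n)

ℕtoℚ : ℕ → ℚ
ℕtoℚ m = + m / 1

sumℚ : List ℚ → ℚ
sumℚ = foldr _+_ 0ℚ

-- eulersRev n x = [E_n(x), E_{n-1}(x), ..., E_0(x)], computed from the
-- coefficient identity obtained from E(t,x)(e^t + 1) = 2 e^{tx}: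
--   sum_{k=0}^{n} C(n,k) E_k(x) + E_n(x) = 2 x^n,  i.e.
--   E_n(x) = x^n - 1/2 * sum_{k=0}^{n-1} C(n,k) E_k(x).
eulersRev : ℕ → ℚ → List ℚ
eulersRev zero x = 1ℚ ∷ []
eulersRev (suc n) x =
  (x ^ℚ suc n - ½ * sumℚ (zipWith (λ k e → ℕtoℚ (suc n C k) * e) (downFrom (suc n)) es)) ∷ es
  where
  es : List ℚ
  es = eulersRev n x

headℚ : List ℚ → ℚ
headℚ []      = 0ℚ
headℚ (y ∷ _) = y

euler : ℕ → ℚ → ℚ
euler n x = headℚ (eulersRev n x)

-- k / (k - i) as a rational; the denominator k - i is ≥ 1 whenever k ≥ 1 and
-- i ≤ ⌊k/2⌋, so the zero-denominator branch is only reached for k = 0.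
ratio : ℕ → ℕ → ℚ
ratio m zero    = 0ℚ
ratio m (suc d) = + m / suc d

dickson : ℕ → ℚ → ℚ → ℚ
dickson k x a =
  sumℚ (map (λ i → ratio k (k ℕ.∸ i) * ℕtoℚ ((k ℕ.∸ i) C i) * ((- a) ^ℚ i) * (x ^ℚ (k ℕ.∸ (2 ℕ.* i))))
            (upTo (suc ⌊ k /2⌋)))

-- A polynomial function on ℚ determines its coefficients, so an identity
-- E_n (c x + d) = u p(x) + v forces equal degrees and equal top coefficients.
-- The recurrence for the Euler polynomials gives their first coefficients,
--   E_n(x) = x^n − (n/2) x^(n−1) + (1/4) C(n,3) x^(n−3) + O(x^(n−5)),
-- so the coefficient of x^(n−1) in E_n (c x + d) is n c^(n−1) (d − 1/2), which
-- forces d = 1/2. For p = x^q the coefficient of x^(q−2) must then vanish, but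
-- it is C(n,2) c^(n−2) (d² − d) ≠ 0. For p = D_k(·, a), whose expansion starts
-- x^k − k a x^(k−2) + (k(k−3)/2) a² x^(k−4), the coefficients of x^k and x^(k−2)
-- give u = c^k and c² a = (k−1)/8, and then the coefficients of x^(k−4) differ
-- by c^(k−4) k (k−1) (k−3) (2k−7) / 384 ≠ 0.
module Submission where

open import Defs
open import Data.Nat as ℕ using (ℕ; zero; suc; _≤_; _<_; z≤n; s≤s; ⌊_/2⌋)
import Data.Nat.Properties as ℕₚ
open import Data.Nat.Combinatorics using (_C_; nCk+nC[k+1]≡[n+1]C[k+1]; nC1≡n; k>n⇒nCk≡0; nCk≡nC[n∸k])
open import Data.Nat.Coprimality as Coprime using ()
open import Data.Integer as ℤ using (+_)
import Data.Integer.Properties as ℤₚ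
open import Data.Sign using (Sign)
open import Data.Rational using (ℚ; 0ℚ; 1ℚ; ½; _+_; _*_; _-_; -_; _/_; mkℚ; ↥_; 1/_; ≢-nonZero; toℚᵘ)
import Data.Rational.Properties as ℚₚ
import Data.Rational.Unnormalised as ℚᵘ
import Data.Rational.Unnormalised.Properties as ℚᵘₚ
open import Data.Rational.Solver using (module +-*-Solver)
open +-*-Solver
open import Data.List using (List; []; _∷_; map; zipWith; downFrom; upTo)
open import Data.List.Properties using (zipWith-cong; zipWith-map; map-id; map-∘; map-cong; map-cong-local)
open import Data.List.Relation.Unary.All using (All; []; _∷_)
open import Data.List.Relation.Unary.All.Properties using (applyUpTo⁺₁; applyUpTo⁺₂)
open import Data.Product using (Σ; _×_; _,_; proj₁)
open import Data.Empty using (⊥-elim)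
open import Relation.Binary.Definitions using (tri<; tri≈; tri>)
open import Relation.Binary.PropositionalEquality
open import Relation.Nullary using (¬_)

ℕtoℚ≡mkℚ : ∀ m → ℕtoℚ m ≡ mkℚ (+ m) 0 (Coprime.sym (Coprime.1-coprimeTo m))
ℕtoℚ≡mkℚ m = ℚₚ.normalize-coprime (Coprime.sym (Coprime.1-coprimeTo m))

ℕtoℚ-+ : ∀ m n → ℕtoℚ (m ℕ.+ n) ≡ ℕtoℚ m + ℕtoℚ n
ℕtoℚ-+ m n = trans (ℚₚ./-cong numerators refl) (sym (cong₂ _+_ (ℕtoℚ≡mkℚ m) (ℕtoℚ≡mkℚ n)))
  where
  numerators : + (m ℕ.+ n) ≡ (Sign.+ ℤ.◃ m ℕ.* 1) ℤ.+ (Sign.+ ℤ.◃ n ℕ.* 1)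
  numerators rewrite ℕₚ.*-identityʳ m | ℕₚ.*-identityʳ n | ℤₚ.+◃n≡+n m | ℤₚ.+◃n≡+n n = refl

ℕtoℚ-* : ∀ m n → ℕtoℚ (m ℕ.* n) ≡ ℕtoℚ m * ℕtoℚ n
ℕtoℚ-* m n = trans (ℚₚ./-cong (sym (ℤₚ.+◃n≡+n (m ℕ.* n))) refl) (sym (cong₂ _*_ (ℕtoℚ≡mkℚ m) (ℕtoℚ≡mkℚ n)))

ℕtoℚ-injective : ∀ m n → ℕtoℚ m ≡ ℕtoℚ n → m ≡ n
ℕtoℚ-injective m n eq = ℤₚ.+-injective (cong ↥_ (trans (sym (ℕtoℚ≡mkℚ m)) (trans eq (ℕtoℚ≡mkℚ n))))

ℕtoℚ-suc≢0 : ∀ m → ℕtoℚ (suc m) ≢ 0ℚ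
ℕtoℚ-suc≢0 m eq with ℕtoℚ-injective (suc m) 0 eq
... | ()

ℕtoℚ-suc+≢0 : ∀ k m → ℕtoℚ (suc k) + ℕtoℚ m ≢ 0ℚ
ℕtoℚ-suc+≢0 k m eq = ℕtoℚ-suc≢0 (k ℕ.+ m) (trans (ℕtoℚ-+ (suc k) m) eq)

p*q≡0⇒q≡0 : ∀ p q → p ≢ 0ℚ → p * q ≡ 0ℚ → q ≡ 0ℚ
p*q≡0⇒q≡0 p q p≢0 pq≡0 = begin
  q                ≡⟨ sym (ℚₚ.*-identityˡ q) ⟩
  1ℚ * q           ≡⟨ cong (_* q) (sym (ℚₚ.*-inverseˡ p)) ⟩
  1/ p * p * q     ≡⟨ ℚₚ.*-assoc (1/ p) p q ⟩
  1/ p * (p * q)   ≡⟨ cong (1/ p *_) pq≡0 ⟩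
  1/ p * 0ℚ        ≡⟨ ℚₚ.*-zeroʳ (1/ p) ⟩
  0ℚ               ∎
  where
  open ≡-Reasoning
  instance _ = ≢-nonZero p≢0

*-≢0 : ∀ {p q} → p ≢ 0ℚ → q ≢ 0ℚ → p * q ≢ 0ℚ
*-≢0 {p} {q} p≢0 q≢0 pq≡0 = q≢0 (p*q≡0⇒q≡0 p q p≢0 pq≡0)

^-≢0 : ∀ {p} n → p ≢ 0ℚ → p ^ℚ n ≢ 0ℚ
^-≢0 zero    p≢0 ()
^-≢0 (suc n) p≢0 = *-≢0 p≢0 (^-≢0 n p≢0)

1^n≡1 : ∀ n → 1ℚ ^ℚ n ≡ 1ℚ
1^n≡1 zero    = refl
1^n≡1 (suc n) = trans (ℚₚ.*-identityˡ _) (1^n≡1 n)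

p-q≡0⇒p≡q : ∀ p q → p - q ≡ 0ℚ → p ≡ q
p-q≡0⇒p≡q p q p-q≡0 = begin
  p              ≡⟨ solve 2 (λ p q → p := (p :- q) :+ q) refl p q ⟩
  (p - q) + q    ≡⟨ cong (_+ q) p-q≡0 ⟩
  0ℚ + q         ≡⟨ ℚₚ.+-identityˡ q ⟩
  q              ∎
  where open ≡-Reasoning

p≡q⇒p-q≡0 : ∀ {p q} → p ≡ q → p - q ≡ 0ℚ
p≡q⇒p-q≡0 {p} refl = ℚₚ.+-inverseʳ p

p*q≡q⇒p≡1 : ∀ p q → q ≢ 0ℚ → p * q ≡ q → p ≡ 1ℚ
p*q≡q⇒p≡1 p q q≢0 pq≡q = p-q≡0⇒p≡q p 1ℚ (p*q≡0⇒q≡0 q (p - 1ℚ) q≢0 q[p-1]≡0)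
  where
  q[p-1]≡0 : q * (p - 1ℚ) ≡ 0ℚ
  q[p-1]≡0 = trans (solve 2 (λ p q → q :* (p :- con 1ℚ) := p :* q :- q) refl p q) (p≡q⇒p-q≡0 pq≡q)

ℕtoℚ-pascal : ∀ n k → ℕtoℚ (suc n C suc k) ≡ ℕtoℚ (n C k) + ℕtoℚ (n C suc k)
ℕtoℚ-pascal n k = trans (cong ℕtoℚ (sym (nCk+nC[k+1]≡[n+1]C[k+1] n k))) (ℕtoℚ-+ (n C k) (n C suc k))

ℕtoℚ[nC2] : ∀ n → ℕtoℚ (n C 2) ≡ ℕtoℚ n * (ℕtoℚ n - 1ℚ) * ½
ℕtoℚ[nC2] zero    = refl
ℕtoℚ[nC2] (suc n) = begin
  ℕtoℚ (suc n C 2)                        ≡⟨ ℕtoℚ-pascal n 1 ⟩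
  ℕtoℚ (n C 1) + ℕtoℚ (n C 2)             ≡⟨ cong₂ _+_ (cong ℕtoℚ (nC1≡n n)) (ℕtoℚ[nC2] n) ⟩
  N + N * (N - 1ℚ) * ½                    ≡⟨ solve 1 (λ N → N :+ N :* (N :- con 1ℚ) :* con ½
                                                := (con 1ℚ :+ N) :* ((con 1ℚ :+ N) :- con 1ℚ) :* con ½) refl N ⟩
  (1ℚ + N) * ((1ℚ + N) - 1ℚ) * ½          ≡⟨ cong (λ z → z * (z - 1ℚ) * ½) (sym (ℕtoℚ-+ 1 n)) ⟩
  ℕtoℚ (suc n) * (ℕtoℚ (suc n) - 1ℚ) * ½  ∎
  where
  open ≡-Reasoning
  N = ℕtoℚ n

ℕtoℚ[nC3] : ∀ n → ℕtoℚ (n C 3) ≡ ℕtoℚ n * (ℕtoℚ n - 1ℚ) * (ℕtoℚ n - ℕtoℚ 2) * (+ 1 / 6)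
ℕtoℚ[nC3] zero    = refl
ℕtoℚ[nC3] (suc n) = begin
  ℕtoℚ (suc n C 3)                        ≡⟨ ℕtoℚ-pascal n 2 ⟩
  ℕtoℚ (n C 2) + ℕtoℚ (n C 3)             ≡⟨ cong₂ _+_ (ℕtoℚ[nC2] n) (ℕtoℚ[nC3] n) ⟩
  N * (N - 1ℚ) * ½ + N * (N - 1ℚ) * (N - ℕtoℚ 2) * (+ 1 / 6)
    ≡⟨ solve 1 (λ N → N :* (N :- con 1ℚ) :* con ½ :+ N :* (N :- con 1ℚ) :* (N :- con (ℕtoℚ 2)) :* con (+ 1 / 6)
                  := S N :* (S N :- con 1ℚ) :* (S N :- con (ℕtoℚ 2)) :* con (+ 1 / 6)) refl N ⟩
  (1ℚ + N) * ((1ℚ + N) - 1ℚ) * ((1ℚ + N) - ℕtoℚ 2) * (+ 1 / 6)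
    ≡⟨ cong (λ z → z * (z - 1ℚ) * (z - ℕtoℚ 2) * (+ 1 / 6)) (sym (ℕtoℚ-+ 1 n)) ⟩
  ℕtoℚ (suc n) * (ℕtoℚ (suc n) - 1ℚ) * (ℕtoℚ (suc n) - ℕtoℚ 2) * (+ 1 / 6)  ∎
  where
  open ≡-Reasoning
  N = ℕtoℚ n
  S : ∀ {k} → Polynomial k → Polynomial k
  S N = con 1ℚ :+ N

ℕtoℚ[nC4] : ∀ n → ℕtoℚ (n C 4) ≡ ℕtoℚ n * (ℕtoℚ n - 1ℚ) * (ℕtoℚ n - ℕtoℚ 2) * (ℕtoℚ n - ℕtoℚ 3) * (+ 1 / 24)
ℕtoℚ[nC4] zero    = refl
ℕtoℚ[nC4] (suc n) = begin
  ℕtoℚ (suc n C 4)                        ≡⟨ ℕtoℚ-pascal n 3 ⟩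
  ℕtoℚ (n C 3) + ℕtoℚ (n C 4)             ≡⟨ cong₂ _+_ (ℕtoℚ[nC3] n) (ℕtoℚ[nC4] n) ⟩
  N * (N - 1ℚ) * (N - ℕtoℚ 2) * (+ 1 / 6) + N * (N - 1ℚ) * (N - ℕtoℚ 2) * (N - ℕtoℚ 3) * (+ 1 / 24)
    ≡⟨ solve 1 (λ N → N :* (N :- con 1ℚ) :* (N :- con (ℕtoℚ 2)) :* con (+ 1 / 6)
                        :+ N :* (N :- con 1ℚ) :* (N :- con (ℕtoℚ 2)) :* (N :- con (ℕtoℚ 3)) :* con (+ 1 / 24)
                  := S N :* (S N :- con 1ℚ) :* (S N :- con (ℕtoℚ 2)) :* (S N :- con (ℕtoℚ 3)) :* con (+ 1 / 24)) refl N ⟩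
  (1ℚ + N) * ((1ℚ + N) - 1ℚ) * ((1ℚ + N) - ℕtoℚ 2) * ((1ℚ + N) - ℕtoℚ 3) * (+ 1 / 24)
    ≡⟨ cong (λ z → z * (z - 1ℚ) * (z - ℕtoℚ 2) * (z - ℕtoℚ 3) * (+ 1 / 24)) (sym (ℕtoℚ-+ 1 n)) ⟩
  ℕtoℚ (suc n) * (ℕtoℚ (suc n) - 1ℚ) * (ℕtoℚ (suc n) - ℕtoℚ 2) * (ℕtoℚ (suc n) - ℕtoℚ 3) * (+ 1 / 24)  ∎
  where
  open ≡-Reasoning
  N = ℕtoℚ n
  S : ∀ {k} → Polynomial k → Polynomial k
  S N = con 1ℚ :+ N

-- Polynomials as coefficient sequences

Coeffs : Set
Coeffs = ℕ → ℚ

-- horner N κ x = Σ_{l ≤ N} κ l · x ^ (N ∸ l): coefficients are listed from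
-- the top down, so κ 0 is the coefficient of x ^ N.
horner : ℕ → Coeffs → ℚ → ℚ
horner zero    κ x = κ 0
horner (suc N) κ x = horner N κ x * x + κ (suc N)

xᴺ : Coeffs
xᴺ zero    = 1ℚ
xᴺ (suc _) = 0ℚ

shift : Coeffs → Coeffs
shift κ zero    = 0ℚ
shift κ (suc l) = κ l

shiftBy : ℕ → Coeffs → Coeffs
shiftBy zero    κ = κ
shiftBy (suc j) κ = shift (shiftBy j κ)

tail : Coeffs → Coeffs
tail κ l = κ (suc l)

truncate : ℕ → Coeffs → Coeffs
truncate N       κ zero    = κ zero
truncate zero    κ (suc l) = 0ℚ
truncate (suc N) κ (suc l) = truncate N (tail κ) l

horner-cong : ∀ N {κ μ} → (∀ l → l ≤ N → κ l ≡ μ l) → ∀ x → horner N κ x ≡ horner N μ x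
horner-cong zero    κ≡μ x = κ≡μ 0 z≤n
horner-cong (suc N) κ≡μ x =
  cong₂ (λ p q → p * x + q) (horner-cong N (λ l l≤N → κ≡μ l (ℕₚ.m≤n⇒m≤1+n l≤N)) x) (κ≡μ (suc N) ℕₚ.≤-refl)

horner-+ : ∀ N κ μ x → horner N (λ l → κ l + μ l) x ≡ horner N κ x + horner N μ x
horner-+ zero    κ μ x = refl
horner-+ (suc N) κ μ x rewrite horner-+ N κ μ x =
  solve 5 (λ p q x a b → (p :+ q) :* x :+ (a :+ b) := (p :* x :+ a) :+ (q :* x :+ b))
    refl (horner N κ x) (horner N μ x) x (κ (suc N)) (μ (suc N))

horner-* : ∀ N a κ x → horner N (λ l → a * κ l) x ≡ a * horner N κ x
horner-* zero    a κ x = refl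
horner-* (suc N) a κ x rewrite horner-* N a κ x =
  solve 4 (λ a p x b → a :* p :* x :+ a :* b := a :* (p :* x :+ b)) refl a (horner N κ x) x (κ (suc N))

horner-neg : ∀ N κ x → horner N (λ l → - κ l) x ≡ - horner N κ x
horner-neg zero    κ x = refl
horner-neg (suc N) κ x rewrite horner-neg N κ x =
  solve 3 (λ p x b → (:- p) :* x :+ (:- b) := :- (p :* x :+ b)) refl (horner N κ x) x (κ (suc N))

horner-0 : ∀ N x → horner N (λ _ → 0ℚ) x ≡ 0ℚ
horner-0 zero    x = refl
horner-0 (suc N) x rewrite horner-0 N x = solve 1 (λ x → con 0ℚ :* x :+ con 0ℚ := con 0ℚ) refl x

horner-shift : ∀ N κ x → horner (suc N) (shift κ) x ≡ horner N κ x
horner-shift zero    κ x = solve 2 (λ x b → con 0ℚ :* x :+ b := b) refl x (κ 0)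
horner-shift (suc N) κ x rewrite horner-shift N κ x = refl

horner-shiftBy : ∀ j N κ x → horner (j ℕ.+ N) (shiftBy j κ) x ≡ horner N κ x
horner-shiftBy zero    N κ x = refl
horner-shiftBy (suc j) N κ x = trans (horner-shift (j ℕ.+ N) (shiftBy j κ) x) (horner-shiftBy j N κ x)

shiftBy-< : ∀ j κ l → l < j → shiftBy j κ l ≡ 0ℚ
shiftBy-< (suc j) κ zero    _         = refl
shiftBy-< (suc j) κ (suc l) (s≤s l<j) = shiftBy-< j κ l l<j

horner-xᴺ : ∀ N x → horner N xᴺ x ≡ x ^ℚ N
horner-xᴺ zero    x = refl
horner-xᴺ (suc N) x rewrite horner-xᴺ N x = solve 2 (λ x p → p :* x :+ con 0ℚ := x :* p) refl x (x ^ℚ N)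

horner-shiftBy-xᴺ : ∀ N j x → j ≤ N → horner N (shiftBy j xᴺ) x ≡ x ^ℚ (N ℕ.∸ j)
horner-shiftBy-xᴺ N j x j≤N = begin
  horner N (shiftBy j xᴺ) x                  ≡⟨ cong (λ M → horner M (shiftBy j xᴺ) x) (sym (ℕₚ.m+[n∸m]≡n j≤N)) ⟩
  horner (j ℕ.+ (N ℕ.∸ j)) (shiftBy j xᴺ) x  ≡⟨ horner-shiftBy j (N ℕ.∸ j) xᴺ x ⟩
  horner (N ℕ.∸ j) xᴺ x                      ≡⟨ horner-xᴺ (N ℕ.∸ j) x ⟩
  x ^ℚ (N ℕ.∸ j)                             ∎
  where open ≡-Reasoning

horner-constant : ∀ N v x → horner N (shiftBy N (λ l → v * xᴺ l)) x ≡ v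
horner-constant N v x =
  trans (cong (λ M → horner M (shiftBy N (λ l → v * xᴺ l)) x) (sym (ℕₚ.+-identityʳ N)))
        (trans (horner-shiftBy N 0 _ x) (ℚₚ.*-identityʳ v))

horner-suc : ∀ N κ x → horner (suc N) κ x ≡ κ 0 * x ^ℚ suc N + horner N (tail κ) x
horner-suc zero    κ x = solve 3 (λ a x b → a :* x :+ b := a :* (x :* con 1ℚ) :+ b) refl (κ 0) x (κ 1)
horner-suc (suc N) κ x rewrite horner-suc N κ x =
  solve 5 (λ a p q x b → (a :* p :+ q) :* x :+ b := a :* (x :* p) :+ (q :* x :+ b))
    refl (κ 0) (x ^ℚ suc N) (horner N (tail κ) x) x (κ (suc (suc N)))

truncate-≤ : ∀ N κ l → l ≤ N → truncate N κ l ≡ κ l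
truncate-≤ N       κ zero    _         = refl
truncate-≤ (suc N) κ (suc l) (s≤s l≤N) = truncate-≤ N (tail κ) l l≤N

truncate-> : ∀ N κ l → N < l → truncate N κ l ≡ 0ℚ
truncate-> zero    κ (suc l) _         = refl
truncate-> (suc N) κ (suc l) (s≤s N<l) = truncate-> N (tail κ) l N<l

horner-truncate : ∀ N κ x → horner (suc N) (truncate N κ) x ≡ horner N κ x * x
horner-truncate N κ x = begin
  horner N (truncate N κ) x * x + truncate N κ (suc N)  ≡⟨ cong₂ (λ p q → p * x + q)
                                                            (horner-cong N (truncate-≤ N κ) x)
                                                            (truncate-> N κ (suc N) ℕₚ.≤-refl) ⟩
  horner N κ x * x + 0ℚ                                ≡⟨ ℚₚ.+-identityʳ _ ⟩
  horner N κ x * x                                     ∎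
  where open ≡-Reasoning

-- Composition with an affine map x ↦ c x + d

module Affine (c d : ℚ) where

  mulAffine : ℕ → Coeffs → Coeffs
  mulAffine N κ l = c * truncate N κ l + d * shift κ l

  horner-mulAffine : ∀ N κ x → horner (suc N) (mulAffine N κ) x ≡ (c * x + d) * horner N κ x
  horner-mulAffine N κ x = begin
    horner (suc N) (mulAffine N κ) x
      ≡⟨ horner-+ (suc N) (λ l → c * truncate N κ l) (λ l → d * shift κ l) x ⟩
    horner (suc N) (λ l → c * truncate N κ l) x + horner (suc N) (λ l → d * shift κ l) x
      ≡⟨ cong₂ _+_ (horner-* (suc N) c (truncate N κ) x) (horner-* (suc N) d (shift κ) x) ⟩
    c * horner (suc N) (truncate N κ) x + d * horner (suc N) (shift κ) x
      ≡⟨ cong₂ (λ p q → c * p + d * q) (horner-truncate N κ x) (horner-shift N κ x) ⟩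
    c * (horner N κ x * x) + d * horner N κ x
      ≡⟨ solve 4 (λ c d p x → c :* (p :* x) :+ d :* p := (c :* x :+ d) :* p) refl c d (horner N κ x) x ⟩
    (c * x + d) * horner N κ x
      ∎
    where open ≡-Reasoning

  affinePow : ℕ → Coeffs
  affinePow zero    = xᴺ
  affinePow (suc m) = mulAffine m (affinePow m)

  horner-affinePow : ∀ m x → horner m (affinePow m) x ≡ (c * x + d) ^ℚ m
  horner-affinePow zero    x = refl
  horner-affinePow (suc m) x =
    trans (horner-mulAffine m (affinePow m) x) (cong ((c * x + d) *_) (horner-affinePow m x))

  -- The binomial theorem, indexed so that no subtraction occurs:
  -- the coefficient of x ^ r in (c x + d) ^ (l + r).
  affinePow-coeff : ∀ l r → affinePow (l ℕ.+ r) l ≡ ℕtoℚ ((l ℕ.+ r) C l) * c ^ℚ r * d ^ℚ l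
  affinePow-coeff-below : ∀ l r →
    c * truncate (l ℕ.+ r) (affinePow (l ℕ.+ r)) (suc l) ≡ ℕtoℚ ((l ℕ.+ r) C suc l) * c ^ℚ r * d ^ℚ suc l

  affinePow-coeff zero zero    = refl
  affinePow-coeff zero (suc r) = begin
    c * affinePow r 0 + d * 0ℚ          ≡⟨ cong (λ p → c * p + d * 0ℚ) (affinePow-coeff zero r) ⟩
    c * (1ℚ * c ^ℚ r * 1ℚ) + d * 0ℚ     ≡⟨ solve 3 (λ c d p → c :* (con 1ℚ :* p :* con 1ℚ) :+ d :* con 0ℚ
                                              := con 1ℚ :* (c :* p) :* con 1ℚ) refl c d (c ^ℚ r) ⟩
    1ℚ * c ^ℚ suc r * 1ℚ                ∎
    where open ≡-Reasoning
  affinePow-coeff (suc l) r = begin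
    c * truncate m (affinePow m) (suc l) + d * affinePow m l
      ≡⟨ cong₂ (λ p q → p + d * q) (affinePow-coeff-below l r) (affinePow-coeff l r) ⟩
    ℕtoℚ (m C suc l) * c ^ℚ r * d ^ℚ suc l + d * (ℕtoℚ (m C l) * c ^ℚ r * d ^ℚ l)
      ≡⟨ solve 5 (λ B A p d q → B :* p :* (d :* q) :+ d :* (A :* p :* q) := (A :+ B) :* p :* (d :* q))
           refl (ℕtoℚ (m C suc l)) (ℕtoℚ (m C l)) (c ^ℚ r) d (d ^ℚ l) ⟩
    (ℕtoℚ (m C l) + ℕtoℚ (m C suc l)) * c ^ℚ r * d ^ℚ suc l
      ≡⟨ cong (λ z → z * c ^ℚ r * d ^ℚ suc l) (sym (ℕtoℚ-pascal m l)) ⟩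
    ℕtoℚ (suc m C suc l) * c ^ℚ r * d ^ℚ suc l
      ∎
    where
    open ≡-Reasoning
    m = l ℕ.+ r

  affinePow-coeff-below l zero = begin
    c * truncate (l ℕ.+ 0) (affinePow (l ℕ.+ 0)) (suc l)   ≡⟨ cong (c *_) (truncate-> _ _ (suc l) l+0<1+l) ⟩
    c * 0ℚ                                                  ≡⟨ solve 2 (λ c q → c :* con 0ℚ := con 0ℚ :* con 1ℚ :* q) refl c (d ^ℚ suc l) ⟩
    ℕtoℚ 0 * 1ℚ * d ^ℚ suc l                                ≡⟨ cong (λ k → ℕtoℚ k * 1ℚ * d ^ℚ suc l) (sym (k>n⇒nCk≡0 l+0<1+l)) ⟩
    ℕtoℚ ((l ℕ.+ 0) C suc l) * 1ℚ * d ^ℚ suc l              ∎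
    where
    open ≡-Reasoning
    l+0<1+l : l ℕ.+ 0 < suc l
    l+0<1+l = s≤s (ℕₚ.≤-reflexive (ℕₚ.+-identityʳ l))
  affinePow-coeff-below l (suc r) = begin
    c * truncate m (affinePow m) (suc l)          ≡⟨ cong (c *_) (truncate-≤ m (affinePow m) (suc l) 1+l≤m) ⟩
    c * affinePow m (suc l)                       ≡⟨ cong (λ k → c * affinePow k (suc l)) (ℕₚ.+-suc l r) ⟩
    c * affinePow (suc l ℕ.+ r) (suc l)           ≡⟨ cong (c *_) (affinePow-coeff (suc l) r) ⟩
    c * (ℕtoℚ ((suc l ℕ.+ r) C suc l) * c ^ℚ r * d ^ℚ suc l)
      ≡⟨ solve 4 (λ c A p q → c :* (A :* p :* q) := A :* (c :* p) :* q) refl c (ℕtoℚ ((suc l ℕ.+ r) C suc l)) (c ^ℚ r) (d ^ℚ suc l) ⟩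
    ℕtoℚ ((suc l ℕ.+ r) C suc l) * c ^ℚ suc r * d ^ℚ suc l
      ≡⟨ cong (λ k → ℕtoℚ (k C suc l) * c ^ℚ suc r * d ^ℚ suc l) (sym (ℕₚ.+-suc l r)) ⟩
    ℕtoℚ (m C suc l) * c ^ℚ suc r * d ^ℚ suc l    ∎
    where
    open ≡-Reasoning
    m = l ℕ.+ suc r
    1+l≤m : suc l ≤ m
    1+l≤m = ℕₚ.≤-trans (s≤s (ℕₚ.m≤m+n l r)) (ℕₚ.≤-reflexive (sym (ℕₚ.+-suc l r)))

  compose : ℕ → Coeffs → Coeffs
  compose zero    κ l = κ 0 * xᴺ l
  compose (suc N) κ l = κ 0 * affinePow (suc N) l + shift (compose N (tail κ)) l

  horner-compose : ∀ N κ x → horner N (compose N κ) x ≡ horner N κ (c * x + d)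
  horner-compose zero    κ x = ℚₚ.*-identityʳ (κ 0)
  horner-compose (suc N) κ x = begin
    horner (suc N) (compose (suc N) κ) x
      ≡⟨ horner-+ (suc N) (λ l → κ 0 * affinePow (suc N) l) (shift (compose N (tail κ))) x ⟩
    horner (suc N) (λ l → κ 0 * affinePow (suc N) l) x + horner (suc N) (shift (compose N (tail κ))) x
      ≡⟨ cong₂ _+_ (trans (horner-* (suc N) (κ 0) (affinePow (suc N)) x) (cong (κ 0 *_) (horner-affinePow (suc N) x)))
                   (trans (horner-shift N _ x) (horner-compose N (tail κ) x)) ⟩
    κ 0 * (c * x + d) ^ℚ suc N + horner N (tail κ) (c * x + d)
      ≡⟨ sym (horner-suc N κ (c * x + d)) ⟩
    horner (suc N) κ (c * x + d)
      ∎
    where open ≡-Reasoning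

  compose-0 : ∀ N κ → compose N κ 0 ≡ κ 0 * c ^ℚ N
  compose-0 zero    κ = refl
  compose-0 (suc N) κ = trans (ℚₚ.+-identityʳ _) (cong (κ 0 *_) (trans (affinePow-coeff 0 (suc N))
    (solve 1 (λ p → con 1ℚ :* p :* con 1ℚ := p) refl (c ^ℚ suc N))))

-- A polynomial function on ℚ determines its coefficients

open Affine 1ℚ 1ℚ using () renaming (compose to translate; horner-compose to horner-translate;
  compose-0 to translate-0; affinePow to [x+1]^; affinePow-coeff to [x+1]^-coeff)

difference : ℕ → Coeffs → Coeffs
difference N κ j = translate (suc N) κ (suc j) - κ (suc j)

horner-difference : ∀ N κ x →
  horner N (difference N κ) x ≡ horner (suc N) κ (1ℚ * x + 1ℚ) - horner (suc N) κ x
horner-difference N κ x = begin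
  horner N (difference N κ) x
    ≡⟨ horner-+ N (tail κ′) (λ j → - κ (suc j)) x ⟩
  horner N (tail κ′) x + horner N (λ j → - κ (suc j)) x
    ≡⟨ cong (λ q → horner N (tail κ′) x + q) (horner-neg N (tail κ) x) ⟩
  horner N (tail κ′) x - horner N (tail κ) x
    ≡⟨ solve 4 (λ a b k X → a :- b := (k :* X :+ a) :- (k :* X :+ b)) refl
         (horner N (tail κ′) x) (horner N (tail κ) x) (κ 0) (x ^ℚ suc N) ⟩
  (κ 0 * x ^ℚ suc N + horner N (tail κ′) x) - (κ 0 * x ^ℚ suc N + horner N (tail κ) x)
    ≡⟨ cong₂ (λ k q → (k * x ^ℚ suc N + horner N (tail κ′) x) - q) (sym κ′0≡κ0) (sym (horner-suc N κ x)) ⟩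
  (κ′ 0 * x ^ℚ suc N + horner N (tail κ′) x) - horner (suc N) κ x
    ≡⟨ cong (_- horner (suc N) κ x) (trans (sym (horner-suc N κ′ x)) (horner-translate (suc N) κ x)) ⟩
  horner (suc N) κ (1ℚ * x + 1ℚ) - horner (suc N) κ x
    ∎
  where
  open ≡-Reasoning
  κ′ = translate (suc N) κ
  κ′0≡κ0 : κ′ 0 ≡ κ 0
  κ′0≡κ0 = trans (translate-0 (suc N) κ) (trans (cong (κ 0 *_) (1^n≡1 (suc N))) (ℚₚ.*-identityʳ (κ 0)))

difference-0 : ∀ N κ → difference N κ 0 ≡ ℕtoℚ (suc N) * κ 0
difference-0 N κ = begin
  κ 0 * [x+1]^ (suc N) 1 + translate N (tail κ) 0 - κ 1
    ≡⟨ cong₂ (λ p q → κ 0 * p + q - κ 1)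
         (trans ([x+1]^-coeff 1 N) (cong₂ (λ k p → ℕtoℚ k * p * (1ℚ * 1ℚ)) (nC1≡n (suc N)) (1^n≡1 N)))
         (trans (translate-0 N (tail κ)) (cong (κ 1 *_) (1^n≡1 N))) ⟩
  κ 0 * (ℕtoℚ (suc N) * 1ℚ * (1ℚ * 1ℚ)) + κ 1 * 1ℚ - κ 1
    ≡⟨ solve 3 (λ k₀ k₁ n → k₀ :* (n :* con 1ℚ :* (con 1ℚ :* con 1ℚ)) :+ k₁ :* con 1ℚ :- k₁ := n :* k₀)
         refl (κ 0) (κ 1) (ℕtoℚ (suc N)) ⟩
  ℕtoℚ (suc N) * κ 0
    ∎
  where open ≡-Reasoning

-- The top coefficient is read off the finite difference p (x + 1) − p x,
-- a polynomial of lower degree whose top coefficient is (N + 1) κ₀.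
horner-≡0⇒coeffs-≡0 : ∀ N κ → (∀ x → horner N κ x ≡ 0ℚ) → ∀ l → l ≤ N → κ l ≡ 0ℚ
horner-≡0⇒coeffs-≡0 zero    κ p≡0 zero _      = p≡0 0ℚ
horner-≡0⇒coeffs-≡0 (suc N) κ p≡0 l    l≤1+N = coeffs l l≤1+N
  where
  Δ≡0 : ∀ x → horner N (difference N κ) x ≡ 0ℚ
  Δ≡0 x = trans (horner-difference N κ x) (p≡q⇒p-q≡0 (trans (p≡0 _) (sym (p≡0 x))))

  κ0≡0 : κ 0 ≡ 0ℚ
  κ0≡0 = p*q≡0⇒q≡0 (ℕtoℚ (suc N)) (κ 0) (ℕtoℚ-suc≢0 N)
    (trans (sym (difference-0 N κ)) (horner-≡0⇒coeffs-≡0 N (difference N κ) Δ≡0 0 z≤n))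

  tail≡0 : ∀ x → horner N (tail κ) x ≡ 0ℚ
  tail≡0 x = begin
    horner N (tail κ) x                          ≡⟨ solve 2 (λ q X → q := con 0ℚ :* X :+ q) refl _ (x ^ℚ suc N) ⟩
    0ℚ * x ^ℚ suc N + horner N (tail κ) x        ≡⟨ cong (λ k → k * x ^ℚ suc N + horner N (tail κ) x) (sym κ0≡0) ⟩
    κ 0 * x ^ℚ suc N + horner N (tail κ) x       ≡⟨ sym (horner-suc N κ x) ⟩
    horner (suc N) κ x                           ≡⟨ p≡0 x ⟩
    0ℚ                                           ∎
    where open ≡-Reasoning

  coeffs : ∀ l → l ≤ suc N → κ l ≡ 0ℚ
  coeffs zero    _         = κ0≡0
  coeffs (suc l) (s≤s l≤N) = horner-≡0⇒coeffs-≡0 N (tail κ) tail≡0 l l≤N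

horner-injective : ∀ N κ μ → (∀ x → horner N κ x ≡ horner N μ x) → ∀ l → l ≤ N → κ l ≡ μ l
horner-injective N κ μ p≡q l l≤N = p-q≡0⇒p≡q (κ l) (μ l)
  (horner-≡0⇒coeffs-≡0 N (λ j → κ j - μ j) p-q≡0 l l≤N)
  where
  p-q≡0 : ∀ x → horner N (λ j → κ j - μ j) x ≡ 0ℚ
  p-q≡0 x = trans (horner-+ N κ (λ j → - μ j) x)
    (trans (cong (λ q → horner N κ x + q) (horner-neg N μ x)) (p≡q⇒p-q≡0 (p≡q x)))

horner-<-degree : ∀ n k κ μ → n < k → (∀ x → horner n κ x ≡ horner k μ x) → μ 0 ≡ 0ℚ
horner-<-degree n k κ μ n<k p≡q = begin
  μ 0                       ≡⟨ sym (horner-injective k (shiftBy j κ) μ padded 0 z≤n) ⟩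
  shiftBy j κ 0             ≡⟨ shiftBy-< j κ 0 (ℕₚ.m<n⇒0<n∸m n<k) ⟩
  0ℚ                        ∎
  where
  open ≡-Reasoning
  j = k ℕ.∸ n
  padded : ∀ x → horner k (shiftBy j κ) x ≡ horner k μ x
  padded x = trans (cong (λ m → horner m (shiftBy j κ) x) (sym (ℕₚ.m∸n+n≡m (ℕₚ.<⇒≤ n<k))))
                   (trans (horner-shiftBy j n κ x) (p≡q x))

horner-degree-unique : ∀ n k κ μ → (∀ x → horner n κ x ≡ horner k μ x) → κ 0 ≢ 0ℚ → μ 0 ≢ 0ℚ → n ≡ k
horner-degree-unique n k κ μ p≡q κ0≢0 μ0≢0 with ℕₚ.<-cmp n k
... | tri< n<k _ _ = ⊥-elim (μ0≢0 (horner-<-degree n k κ μ n<k p≡q))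
... | tri≈ _ n≡k _ = n≡k
... | tri> _ _ k<n = ⊥-elim (κ0≢0 (horner-<-degree k n μ κ k<n (λ x → sym (p≡q x))))

-- Coefficients of the Euler polynomials

horner-sumℚ-zipWith : ∀ {A B : Set} N (f : A → B → Coeffs) ks bs x →
  horner N (λ l → sumℚ (zipWith (λ k b → f k b l) ks bs)) x ≡ sumℚ (zipWith (λ k b → horner N (f k b) x) ks bs)
horner-sumℚ-zipWith N f []       bs       x = horner-0 N x
horner-sumℚ-zipWith N f (k ∷ ks) []       x = horner-0 N x
horner-sumℚ-zipWith N f (k ∷ ks) (b ∷ bs) x =
  trans (horner-+ N (f k b) (λ l → sumℚ (zipWith (λ k b → f k b l) ks bs)) x)
        (cong (λ s → horner N (f k b) x + s) (horner-sumℚ-zipWith N f ks bs x))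

eulerStep : ℕ → List Coeffs → Coeffs
eulerStep n κs l = xᴺ l - ½ * sumℚ (zipWith (λ k κ → ℕtoℚ (suc n C k) * shift κ l) (downFrom (suc n)) κs)

-- The coefficients of E_n, …, E_0, all with degree bound n.
eulerCoeffsRev : ℕ → List Coeffs
eulerCoeffsRev zero    = xᴺ ∷ []
eulerCoeffsRev (suc n) = eulerStep n (eulerCoeffsRev n) ∷ map shift (eulerCoeffsRev n)

eulerCoeffs : ℕ → Coeffs
eulerCoeffs zero    = xᴺ
eulerCoeffs (suc n) = eulerStep n (eulerCoeffsRev n)

horner-eulerStep : ∀ n κs x → horner (suc n) (eulerStep n κs) x ≡
  x ^ℚ suc n - ½ * sumℚ (zipWith (λ k e → ℕtoℚ (suc n C k) * e) (downFrom (suc n)) (map (λ κ → horner n κ x) κs))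
horner-eulerStep n κs x = begin
  horner (suc n) (eulerStep n κs) x
    ≡⟨ horner-+ (suc n) xᴺ (λ l → - (½ * S l)) x ⟩
  horner (suc n) xᴺ x + horner (suc n) (λ l → - (½ * S l)) x
    ≡⟨ cong₂ _+_ (horner-xᴺ (suc n) x) (trans (horner-neg (suc n) (λ l → ½ * S l) x) (cong -_ (horner-* (suc n) ½ S x))) ⟩
  x ^ℚ suc n - ½ * horner (suc n) S x
    ≡⟨ cong (λ s → x ^ℚ suc n - ½ * s) (horner-sumℚ-zipWith (suc n) (λ k κ l → b k * shift κ l) ks κs x) ⟩
  x ^ℚ suc n - ½ * sumℚ (zipWith (λ k κ → horner (suc n) (λ l → b k * shift κ l) x) ks κs)
    ≡⟨ cong (λ s → x ^ℚ suc n - ½ * sumℚ s) (zipWith-cong (λ k κ →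
         trans (horner-* (suc n) (b k) (shift κ) x) (cong (b k *_) (horner-shift n κ x))) ks κs) ⟩
  x ^ℚ suc n - ½ * sumℚ (zipWith (λ k κ → b k * horner n κ x) ks κs)
    ≡⟨ cong (λ s → x ^ℚ suc n - ½ * sumℚ s) (sym (zipWith-map (λ k e → b k * e) (λ k → k) (λ κ → horner n κ x) ks κs)) ⟩
  x ^ℚ suc n - ½ * sumℚ (zipWith (λ k e → b k * e) (map (λ k → k) ks) (map (λ κ → horner n κ x) κs))
    ≡⟨ cong (λ ks′ → x ^ℚ suc n - ½ * sumℚ (zipWith (λ k e → b k * e) ks′ (map (λ κ → horner n κ x) κs))) (map-id ks) ⟩
  x ^ℚ suc n - ½ * sumℚ (zipWith (λ k e → b k * e) ks (map (λ κ → horner n κ x) κs))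
    ∎
  where
  open ≡-Reasoning
  ks = downFrom (suc n)
  b : ℕ → ℚ
  b k = ℕtoℚ (suc n C k)
  S : Coeffs
  S l = sumℚ (zipWith (λ k κ → b k * shift κ l) ks κs)

horner-eulerCoeffsRev : ∀ n x → map (λ κ → horner n κ x) (eulerCoeffsRev n) ≡ eulersRev n x
horner-eulerCoeffsRev zero    x = refl
horner-eulerCoeffsRev (suc n) x = cong₂ _∷_
  (trans (horner-eulerStep n (eulerCoeffsRev n) x)
         (cong (λ es → x ^ℚ suc n - ½ * sumℚ (zipWith (λ k e → ℕtoℚ (suc n C k) * e) (downFrom (suc n)) es)) IH))
  (trans (trans (sym (map-∘ (eulerCoeffsRev n))) (map-cong (λ κ → horner-shift n κ x) (eulerCoeffsRev n))) IH)
  where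
  IH = horner-eulerCoeffsRev n x

euler≡horner : ∀ n x → euler n x ≡ horner n (eulerCoeffs n) x
euler≡horner zero    x = refl
euler≡horner (suc n) x = sym (cong headℚ (horner-eulerCoeffsRev (suc n) x))

record EulerTop (n : ℕ) : Set where
  field
    coeff₀ : eulerCoeffs n 0 ≡ 1ℚ
    coeff₁ : eulerCoeffs n 1 ≡ - (½ * ℕtoℚ n)
    coeff₂ : eulerCoeffs n 2 ≡ 0ℚ
    coeff₃ : eulerCoeffs n 3 ≡ ℕtoℚ n * (ℕtoℚ n - 1ℚ) * (ℕtoℚ n - ℕtoℚ 2) * (+ 1 / 24)
    coeff₄ : eulerCoeffs n 4 ≡ 0ℚ

[j+m]Cm≡[j+m]Cj : ∀ j m → (j ℕ.+ m) C m ≡ (j ℕ.+ m) C j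
[j+m]Cm≡[j+m]Cj j m = trans (nCk≡nC[n∸k] (ℕₚ.m≤n+m m j)) (cong ((j ℕ.+ m) C_) (ℕₚ.m+n∸n≡m j m))

module EulerTopStep (M : ℕ) where
  open EulerTop

  N Z A₂ A₃ A₄ : ℚ
  N  = ℕtoℚ M
  Z  = ℕtoℚ 5 + N
  A₂ = Z * (Z - 1ℚ) * ½
  A₃ = Z * (Z - 1ℚ) * (Z - ℕtoℚ 2) * (+ 1 / 6)
  A₄ = Z * (Z - 1ℚ) * (Z - ℕtoℚ 2) * (Z - ℕtoℚ 3) * (+ 1 / 24)

  ℕtoℚ[k+M] : ∀ k → ℕtoℚ (k ℕ.+ M) ≡ ℕtoℚ k + N
  ℕtoℚ[k+M] k = ℕtoℚ-+ k M

  binomial : ℕ → ℚ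
  binomial k = ℕtoℚ ((5 ℕ.+ M) C k)

  binomial₁ : binomial (4 ℕ.+ M) ≡ Z
  binomial₁ = trans (cong ℕtoℚ (trans ([j+m]Cm≡[j+m]Cj 1 (4 ℕ.+ M)) (nC1≡n (5 ℕ.+ M)))) (ℕtoℚ[k+M] 5)

  binomial₂ : binomial (3 ℕ.+ M) ≡ A₂
  binomial₂ = trans (cong ℕtoℚ ([j+m]Cm≡[j+m]Cj 2 (3 ℕ.+ M)))
    (trans (ℕtoℚ[nC2] (5 ℕ.+ M)) (cong (λ z → z * (z - 1ℚ) * ½) (ℕtoℚ[k+M] 5)))

  binomial₃ : binomial (2 ℕ.+ M) ≡ A₃
  binomial₃ = trans (cong ℕtoℚ ([j+m]Cm≡[j+m]Cj 3 (2 ℕ.+ M)))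
    (trans (ℕtoℚ[nC3] (5 ℕ.+ M)) (cong (λ z → z * (z - 1ℚ) * (z - ℕtoℚ 2) * (+ 1 / 6)) (ℕtoℚ[k+M] 5)))

  binomial₄ : binomial (1 ℕ.+ M) ≡ A₄
  binomial₄ = trans (cong ℕtoℚ ([j+m]Cm≡[j+m]Cj 4 (1 ℕ.+ M)))
    (trans (ℕtoℚ[nC4] (5 ℕ.+ M)) (cong (λ z → z * (z - 1ℚ) * (z - ℕtoℚ 2) * (z - ℕtoℚ 3) * (+ 1 / 24)) (ℕtoℚ[k+M] 5)))

  E₁ E₂ E₃ E₄ : Coeffs
  E₁ = eulerCoeffs (1 ℕ.+ M)
  E₂ = eulerCoeffs (2 ℕ.+ M)
  E₃ = eulerCoeffs (3 ℕ.+ M)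
  E₄ = eulerCoeffs (4 ℕ.+ M)

  recurrence : ℚ → ℚ → ℚ → ℚ → ℚ → ℚ
  recurrence δ e₄ e₃ e₂ e₁ = δ - ½ * (Z * e₄ + (A₂ * e₃ + (A₃ * e₂ + (A₄ * e₁ + 0ℚ))))

  -- Only E_{M+4}, …, E_{M+1} reach the coefficients l ≤ 4 of E_{M+5}: the
  -- lower ones enter the recurrence shifted at least five times.
  recurrence-at : ∀ l → l ≤ 4 → ∀ {e₄ e₃ e₂ e₁} →
    shiftBy 1 E₄ l ≡ e₄ → shiftBy 2 E₃ l ≡ e₃ → shiftBy 3 E₂ l ≡ e₂ → shiftBy 4 E₁ l ≡ e₁ →
    eulerCoeffs (5 ℕ.+ M) l ≡ recurrence (xᴺ l) e₄ e₃ e₂ e₁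
  recurrence-at l l≤4 ≡e₄ ≡e₃ ≡e₂ ≡e₁ = cong (λ s → xᴺ l - ½ * s)
    (cong₂ _+_ (cong₂ _*_ binomial₁ ≡e₄) (cong₂ _+_ (cong₂ _*_ binomial₂ ≡e₃)
      (cong₂ _+_ (cong₂ _*_ binomial₃ ≡e₂) (cong₂ _+_ (cong₂ _*_ binomial₄ ≡e₁)
        (lower≡0 (downFrom (1 ℕ.+ M)) (eulerCoeffsRev M))))))
    where
    lower≡0 : ∀ ks κs →
      sumℚ (zipWith (λ k κ → binomial k * shift κ l) ks (map shift (map shift (map shift (map shift κs))))) ≡ 0ℚ
    lower≡0 []       κs       = refl
    lower≡0 (k ∷ ks) []       = refl
    lower≡0 (k ∷ ks) (κ ∷ κs) = trans
      (cong₂ _+_ (trans (cong (binomial k *_) (shiftBy-< 5 κ l (s≤s l≤4))) (ℚₚ.*-zeroʳ (binomial k))) (lower≡0 ks κs))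
      (ℚₚ.+-identityˡ 0ℚ)

  Z′ A₂′ A₃′ A₄′ : ∀ {k} → Polynomial k → Polynomial k
  Z′  N = con (ℕtoℚ 5) :+ N
  A₂′ N = Z′ N :* (Z′ N :- con 1ℚ) :* con ½
  A₃′ N = Z′ N :* (Z′ N :- con 1ℚ) :* (Z′ N :- con (ℕtoℚ 2)) :* con (+ 1 / 6)
  A₄′ N = Z′ N :* (Z′ N :- con 1ℚ) :* (Z′ N :- con (ℕtoℚ 2)) :* (Z′ N :- con (ℕtoℚ 3)) :* con (+ 1 / 24)

  recurrence′ : ∀ {k} → Polynomial k → Polynomial k → Polynomial k → Polynomial k → Polynomial k → Polynomial k → Polynomial k
  recurrence′ N δ e₄ e₃ e₂ e₁ = δ :- con ½ :* (Z′ N :* e₄ :+ (A₂′ N :* e₃ :+ (A₃′ N :* e₂ :+ (A₄′ N :* e₁ :+ con 0ℚ))))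

  module _ (P₁ : EulerTop (1 ℕ.+ M)) (P₂ : EulerTop (2 ℕ.+ M)) (P₃ : EulerTop (3 ℕ.+ M)) (P₄ : EulerTop (4 ℕ.+ M)) where

    half[k+M] : ∀ k → - (½ * ℕtoℚ (k ℕ.+ M)) ≡ - (½ * (ℕtoℚ k + N))
    half[k+M] k = cong (λ z → - (½ * z)) (ℕtoℚ[k+M] k)

    next₀ : eulerCoeffs (5 ℕ.+ M) 0 ≡ 1ℚ
    next₀ = trans (recurrence-at 0 z≤n refl refl refl refl)
      (solve 1 (λ N → recurrence′ N (con 1ℚ) (con 0ℚ) (con 0ℚ) (con 0ℚ) (con 0ℚ) := con 1ℚ) refl N)

    next₁ : eulerCoeffs (5 ℕ.+ M) 1 ≡ - (½ * ℕtoℚ (5 ℕ.+ M))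
    next₁ = begin
      eulerCoeffs (5 ℕ.+ M) 1           ≡⟨ recurrence-at 1 (s≤s z≤n) (coeff₀ P₄) refl refl refl ⟩
      recurrence 0ℚ 1ℚ 0ℚ 0ℚ 0ℚ         ≡⟨ solve 1 (λ N → recurrence′ N (con 0ℚ) (con 1ℚ) (con 0ℚ) (con 0ℚ) (con 0ℚ)
                                              := :- (con ½ :* Z′ N)) refl N ⟩
      - (½ * (ℕtoℚ 5 + N))              ≡⟨ sym (half[k+M] 5) ⟩
      - (½ * ℕtoℚ (5 ℕ.+ M))            ∎
      where open ≡-Reasoning

    next₂ : eulerCoeffs (5 ℕ.+ M) 2 ≡ 0ℚ
    next₂ = begin
      eulerCoeffs (5 ℕ.+ M) 2                        ≡⟨ recurrence-at 2 (s≤s (s≤s z≤n))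
                                                          (trans (coeff₁ P₄) (half[k+M] 4)) (coeff₀ P₃) refl refl ⟩
      recurrence 0ℚ (- (½ * (ℕtoℚ 4 + N))) 1ℚ 0ℚ 0ℚ  ≡⟨ solve 1 (λ N → recurrence′ N (con 0ℚ) (:- (con ½ :* (con (ℕtoℚ 4) :+ N)))
                                                            (con 1ℚ) (con 0ℚ) (con 0ℚ) := con 0ℚ) refl N ⟩
      0ℚ                                             ∎
      where open ≡-Reasoning

    next₃ : eulerCoeffs (5 ℕ.+ M) 3 ≡ ℕtoℚ (5 ℕ.+ M) * (ℕtoℚ (5 ℕ.+ M) - 1ℚ) * (ℕtoℚ (5 ℕ.+ M) - ℕtoℚ 2) * (+ 1 / 24)
    next₃ = begin
      eulerCoeffs (5 ℕ.+ M) 3                        ≡⟨ recurrence-at 3 (s≤s (s≤s (s≤s z≤n)))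
                                                          (coeff₂ P₄) (trans (coeff₁ P₃) (half[k+M] 3)) (coeff₀ P₂) refl ⟩
      recurrence 0ℚ 0ℚ (- (½ * (ℕtoℚ 3 + N))) 1ℚ 0ℚ  ≡⟨ solve 1 (λ N → recurrence′ N (con 0ℚ) (con 0ℚ) (:- (con ½ :* (con (ℕtoℚ 3) :+ N)))
                                                            (con 1ℚ) (con 0ℚ)
                                                          := Z′ N :* (Z′ N :- con 1ℚ) :* (Z′ N :- con (ℕtoℚ 2)) :* con (+ 1 / 24)) refl N ⟩
      Z * (Z - 1ℚ) * (Z - ℕtoℚ 2) * (+ 1 / 24)       ≡⟨ cong (λ z → z * (z - 1ℚ) * (z - ℕtoℚ 2) * (+ 1 / 24)) (sym (ℕtoℚ[k+M] 5)) ⟩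
      ℕtoℚ (5 ℕ.+ M) * (ℕtoℚ (5 ℕ.+ M) - 1ℚ) * (ℕtoℚ (5 ℕ.+ M) - ℕtoℚ 2) * (+ 1 / 24)  ∎
      where open ≡-Reasoning

    next₄ : eulerCoeffs (5 ℕ.+ M) 4 ≡ 0ℚ
    next₄ = begin
      eulerCoeffs (5 ℕ.+ M) 4      ≡⟨ recurrence-at 4 ℕₚ.≤-refl
                                       (trans (coeff₃ P₄) (cong (λ z → z * (z - 1ℚ) * (z - ℕtoℚ 2) * (+ 1 / 24)) (ℕtoℚ[k+M] 4)))
                                       (coeff₂ P₃) (trans (coeff₁ P₂) (half[k+M] 2)) (coeff₀ P₁) ⟩
      recurrence 0ℚ (Y * (Y - 1ℚ) * (Y - ℕtoℚ 2) * (+ 1 / 24)) 0ℚ (- (½ * (ℕtoℚ 2 + N))) 1ℚ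
        ≡⟨ solve 1 (λ N → let Y = con (ℕtoℚ 4) :+ N in
                     recurrence′ N (con 0ℚ) (Y :* (Y :- con 1ℚ) :* (Y :- con (ℕtoℚ 2)) :* con (+ 1 / 24)) (con 0ℚ)
                       (:- (con ½ :* (con (ℕtoℚ 2) :+ N))) (con 1ℚ) := con 0ℚ) refl N ⟩
      0ℚ                           ∎
      where
      open ≡-Reasoning
      Y = ℕtoℚ 4 + N

    eulerTop-step : EulerTop (5 ℕ.+ M)
    eulerTop-step = record { coeff₀ = next₀ ; coeff₁ = next₁ ; coeff₂ = next₂ ; coeff₃ = next₃ ; coeff₄ = next₄ }

eulerTop : ∀ n → EulerTop n
eulerTop n = proj₁ (five n)
  where
  five : ∀ n → EulerTop n × EulerTop (1 ℕ.+ n) × EulerTop (2 ℕ.+ n) × EulerTop (3 ℕ.+ n) × EulerTop (4 ℕ.+ n)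
  five zero    = record { coeff₀ = refl ; coeff₁ = refl ; coeff₂ = refl ; coeff₃ = refl ; coeff₄ = refl }
               , record { coeff₀ = refl ; coeff₁ = refl ; coeff₂ = refl ; coeff₃ = refl ; coeff₄ = refl }
               , record { coeff₀ = refl ; coeff₁ = refl ; coeff₂ = refl ; coeff₃ = refl ; coeff₄ = refl }
               , record { coeff₀ = refl ; coeff₁ = refl ; coeff₂ = refl ; coeff₃ = refl ; coeff₄ = refl }
               , record { coeff₀ = refl ; coeff₁ = refl ; coeff₂ = refl ; coeff₃ = refl ; coeff₄ = refl }
  five (suc M) with five M
  ... | _ , P₁ , P₂ , P₃ , P₄ = P₁ , P₂ , P₃ , P₄ , EulerTopStep.eulerTop-step M P₁ P₂ P₃ P₄

-- Coefficients of the Dickson polynomials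

ratio-* : ∀ m e → ratio m (suc e) * ℕtoℚ (suc e) ≡ ℕtoℚ m
ratio-* m e = ℚₚ.toℚᵘ-injective (begin
  toℚᵘ (ratio m (suc e) * ℕtoℚ (suc e))             ≈⟨ ℚₚ.toℚᵘ-homo-* (ratio m (suc e)) (ℕtoℚ (suc e)) ⟩
  toℚᵘ (ratio m (suc e)) ℚᵘ.* toℚᵘ (ℕtoℚ (suc e))  ≈⟨ ℚᵘₚ.*-cong (ℚₚ.toℚᵘ-fromℚᵘ (ℚᵘ.mkℚᵘ (+ m) e))
                                                                 (ℚₚ.toℚᵘ-fromℚᵘ (ℚᵘ.mkℚᵘ (+ suc e) 0)) ⟩
  ℚᵘ.mkℚᵘ (+ m) e ℚᵘ.* ℚᵘ.mkℚᵘ (+ suc e) 0          ≈⟨ ℚᵘ.*≡* (ℤₚ.*-assoc (+ m) (+ suc e) (+ 1)) ⟩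
  ℚᵘ.mkℚᵘ (+ m) 0                                   ≈⟨ ℚᵘₚ.≃-sym (ℚₚ.toℚᵘ-fromℚᵘ (ℚᵘ.mkℚᵘ (+ m) 0)) ⟩
  toℚᵘ (ℕtoℚ m)                                     ∎)
  where open ℚᵘₚ.≃-Reasoning

sumℚ-map-0 : ∀ {A : Set} (f : A → ℚ) {xs} → All (λ x → f x ≡ 0ℚ) xs → sumℚ (map f xs) ≡ 0ℚ
sumℚ-map-0 f []             = refl
sumℚ-map-0 f (fx≡0 ∷ fxs≡0) = trans (cong₂ _+_ fx≡0 (sumℚ-map-0 f fxs≡0)) (ℚₚ.+-identityˡ 0ℚ)

horner-sumℚ-map : ∀ {A : Set} N (f : A → Coeffs) xs x →
  horner N (λ l → sumℚ (map (λ i → f i l) xs)) x ≡ sumℚ (map (λ i → horner N (f i) x) xs)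
horner-sumℚ-map N f []       x = horner-0 N x
horner-sumℚ-map N f (i ∷ xs) x = trans (horner-+ N (f i) (λ l → sumℚ (map (λ i → f i l) xs)) x)
  (cong (λ s → horner N (f i) x + s) (horner-sumℚ-map N f xs x))

2*⌊k/2⌋≤k : ∀ k → 2 ℕ.* ⌊ k /2⌋ ≤ k
2*⌊k/2⌋≤k k = begin
  2 ℕ.* ⌊ k /2⌋              ≡⟨ cong (⌊ k /2⌋ ℕ.+_) (ℕₚ.+-identityʳ ⌊ k /2⌋) ⟩
  ⌊ k /2⌋ ℕ.+ ⌊ k /2⌋        ≤⟨ ℕₚ.+-monoʳ-≤ ⌊ k /2⌋ (ℕₚ.⌊n/2⌋≤⌈n/2⌉ k) ⟩
  ⌊ k /2⌋ ℕ.+ ℕ.⌈ k /2⌉      ≡⟨ ℕₚ.⌊n/2⌋+⌈n/2⌉≡n k ⟩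
  k                          ∎
  where open ℕₚ.≤-Reasoning

dicksonTerm : ℕ → ℚ → ℕ → ℚ
dicksonTerm k a i = ratio k (k ℕ.∸ i) * ℕtoℚ ((k ℕ.∸ i) C i) * ((- a) ^ℚ i)

dicksonCoeffs : ℕ → ℚ → Coeffs
dicksonCoeffs k a l = sumℚ (map (λ i → dicksonTerm k a i * shiftBy (2 ℕ.* i) xᴺ l) (upTo (suc ⌊ k /2⌋)))

horner-dickson : ∀ k a x → horner k (dicksonCoeffs k a) x ≡ dickson k x a
horner-dickson k a x = trans (horner-sumℚ-map k (λ i l → dicksonTerm k a i * shiftBy (2 ℕ.* i) xᴺ l) (upTo (suc ⌊ k /2⌋)) x)
  (cong sumℚ (map-cong-local (applyUpTo⁺₁ (λ i → i) (suc ⌊ k /2⌋) term)))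
  where
  term : ∀ {i} → i < suc ⌊ k /2⌋ →
    horner k (λ l → dicksonTerm k a i * shiftBy (2 ℕ.* i) xᴺ l) x ≡ dicksonTerm k a i * x ^ℚ (k ℕ.∸ 2 ℕ.* i)
  term {i} (s≤s i≤⌊k/2⌋) = trans (horner-* k (dicksonTerm k a i) (shiftBy (2 ℕ.* i) xᴺ) x)
    (cong (dicksonTerm k a i *_) (horner-shiftBy-xᴺ k (2 ℕ.* i) x (ℕₚ.≤-trans (ℕₚ.*-monoʳ-≤ 2 i≤⌊k/2⌋) (2*⌊k/2⌋≤k k))))

module DicksonTop (M : ℕ) (a : ℚ) where

  k : ℕ
  k = 5 ℕ.+ M

  N Z : ℚ
  N = ℕtoℚ M
  Z = ℕtoℚ 5 + N

  T₀ T₁ T₂ : ℚ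
  T₀ = dicksonTerm k a 0
  T₁ = dicksonTerm k a 1
  T₂ = dicksonTerm k a 2

  dicksonCoeffs-top : ∀ l → l ≤ 4 → dicksonCoeffs k a l ≡ T₀ * xᴺ l + (T₁ * shiftBy 2 xᴺ l + (T₂ * shiftBy 4 xᴺ l + 0ℚ))
  dicksonCoeffs-top l l≤4 = cong (λ s → T₀ * xᴺ l + (T₁ * shiftBy 2 xᴺ l + (T₂ * shiftBy 4 xᴺ l + s)))
    (sumℚ-map-0 (λ i → dicksonTerm k a i * shiftBy (2 ℕ.* i) xᴺ l) (applyUpTo⁺₂ (λ i → 3 ℕ.+ i) ⌊ 1 ℕ.+ M /2⌋ vanish))
    where
    vanish : ∀ i → dicksonTerm k a (3 ℕ.+ i) * shiftBy (2 ℕ.* (3 ℕ.+ i)) xᴺ l ≡ 0ℚ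
    vanish i = trans (cong (dicksonTerm k a (3 ℕ.+ i) *_) (shiftBy-< (2 ℕ.* (3 ℕ.+ i)) xᴺ l l<2[3+i]))
                     (ℚₚ.*-zeroʳ (dicksonTerm k a (3 ℕ.+ i)))
      where
      l<2[3+i] : l < 2 ℕ.* (3 ℕ.+ i)
      l<2[3+i] = ℕₚ.≤-trans (s≤s (ℕₚ.m≤n⇒m≤1+n l≤4)) (ℕₚ.*-monoʳ-≤ 2 (ℕₚ.m≤m+n 3 i))

  T₀≡1 : T₀ ≡ 1ℚ
  T₀≡1 = cong (λ r → r * 1ℚ * 1ℚ) (p*q≡q⇒p≡1 (ratio k k) (ℕtoℚ k) (ℕtoℚ-suc≢0 (4 ℕ.+ M)) (ratio-* k (4 ℕ.+ M)))

  T₁≡ : T₁ ≡ - (Z * a)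
  T₁≡ = begin
    ratio k (4 ℕ.+ M) * ℕtoℚ ((4 ℕ.+ M) C 1) * (- a * 1ℚ)  ≡⟨ cong (λ m → ratio k (4 ℕ.+ M) * ℕtoℚ m * (- a * 1ℚ)) (nC1≡n (4 ℕ.+ M)) ⟩
    ratio k (4 ℕ.+ M) * ℕtoℚ (4 ℕ.+ M) * (- a * 1ℚ)        ≡⟨ cong (_* (- a * 1ℚ)) (trans (ratio-* k (3 ℕ.+ M)) (ℕtoℚ-+ 5 M)) ⟩
    Z * (- a * 1ℚ)                                          ≡⟨ solve 2 (λ z a → z :* ((:- a) :* con 1ℚ) := :- (z :* a)) refl Z a ⟩
    - (Z * a)                                               ∎
    where open ≡-Reasoning

  T₂≡ : T₂ ≡ Z * (ℕtoℚ 3 + N - 1ℚ) * ½ * (a * a)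
  T₂≡ = begin
    r * ℕtoℚ ((3 ℕ.+ M) C 2) * (- a * (- a * 1ℚ))           ≡⟨ cong (λ z → r * z * (- a * (- a * 1ℚ))) (ℕtoℚ[nC2] (3 ℕ.+ M)) ⟩
    r * (m * (m - 1ℚ) * ½) * (- a * (- a * 1ℚ))             ≡⟨ solve 3 (λ r m a → r :* (m :* (m :- con 1ℚ) :* con ½) :* ((:- a) :* ((:- a) :* con 1ℚ))
                                                                := (r :* m) :* (m :- con 1ℚ) :* con ½ :* (a :* a)) refl r m a ⟩
    (r * m) * (m - 1ℚ) * ½ * (a * a)                        ≡⟨ cong₂ (λ z w → z * (w - 1ℚ) * ½ * (a * a))
                                                                 (trans (ratio-* k (2 ℕ.+ M)) (ℕtoℚ-+ 5 M)) (ℕtoℚ-+ 3 M) ⟩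
    Z * (ℕtoℚ 3 + N - 1ℚ) * ½ * (a * a)                     ∎
    where
    open ≡-Reasoning
    r = ratio k (3 ℕ.+ M)
    m = ℕtoℚ (3 ℕ.+ M)

  dickson₀ : dicksonCoeffs k a 0 ≡ 1ℚ
  dickson₀ = trans (dicksonCoeffs-top 0 z≤n)
    (trans (solve 3 (λ t₀ t₁ t₂ → t₀ :* con 1ℚ :+ (t₁ :* con 0ℚ :+ (t₂ :* con 0ℚ :+ con 0ℚ)) := t₀) refl T₀ T₁ T₂) T₀≡1)

  dickson₁ : dicksonCoeffs k a 1 ≡ 0ℚ
  dickson₁ = trans (dicksonCoeffs-top 1 (s≤s z≤n))
    (solve 3 (λ t₀ t₁ t₂ → t₀ :* con 0ℚ :+ (t₁ :* con 0ℚ :+ (t₂ :* con 0ℚ :+ con 0ℚ)) := con 0ℚ) refl T₀ T₁ T₂)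

  dickson₂ : dicksonCoeffs k a 2 ≡ - (Z * a)
  dickson₂ = trans (dicksonCoeffs-top 2 (s≤s (s≤s z≤n)))
    (trans (solve 3 (λ t₀ t₁ t₂ → t₀ :* con 0ℚ :+ (t₁ :* con 1ℚ :+ (t₂ :* con 0ℚ :+ con 0ℚ)) := t₁) refl T₀ T₁ T₂) T₁≡)

  dickson₄ : dicksonCoeffs k a 4 ≡ Z * (ℕtoℚ 3 + N - 1ℚ) * ½ * (a * a)
  dickson₄ = trans (dicksonCoeffs-top 4 ℕₚ.≤-refl)
    (trans (solve 3 (λ t₀ t₁ t₂ → t₀ :* con 0ℚ :+ (t₁ :* con 0ℚ :+ (t₂ :* con 1ℚ :+ con 0ℚ)) := t₂) refl T₀ T₁ T₂) T₂≡)

-- The coefficient of x ^ (M + 1) in E_{M+5} (c x + d), divided by c ^ (M + 1).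
quartic : ℕ → ℚ → ℚ
quartic M d = Z * (Z - 1ℚ) * (Z - ℕtoℚ 2) * (Z - ℕtoℚ 3) * (+ 1 / 24) * d ^ℚ 4
            + - (½ * Z) * (Y * (Y - 1ℚ) * (Y - ℕtoℚ 2) * (+ 1 / 6)) * d ^ℚ 3
            + Z * (Z - 1ℚ) * (Z - ℕtoℚ 2) * (+ 1 / 24) * (ℕtoℚ 2 + ℕtoℚ M) * d ^ℚ 1
  where
  Z = ℕtoℚ 5 + ℕtoℚ M
  Y = ℕtoℚ 4 + ℕtoℚ M

module EulerAffine (c d : ℚ) where
  open Affine c d
  open EulerTop

  eulerAffine : ℕ → Coeffs
  eulerAffine n = compose n (eulerCoeffs n)

  euler-affine : ∀ n x → euler n (c * x + d) ≡ horner n (eulerAffine n) x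
  euler-affine n x = trans (euler≡horner n (c * x + d)) (sym (horner-compose n (eulerCoeffs n) x))

  eulerAffine₀ : ∀ n → eulerAffine n 0 ≡ c ^ℚ n
  eulerAffine₀ n = trans (compose-0 n (eulerCoeffs n)) (trans (cong (_* c ^ℚ n) (coeff₀ (eulerTop n))) (ℚₚ.*-identityˡ _))

  eulerAffine₁ : ∀ M → eulerAffine (suc M) 1 ≡ ℕtoℚ (suc M) * c ^ℚ M * (d - ½)
  eulerAffine₁ M = begin
    E 0 * affinePow (suc M) 1 + compose M (tail E) 0
      ≡⟨ cong₂ (λ p q → E 0 * p + q) (affinePow-coeff 1 M) (compose-0 M (tail E)) ⟩
    E 0 * (ℕtoℚ (suc M C 1) * c ^ℚ M * (d * 1ℚ)) + E 1 * c ^ℚ M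
      ≡⟨ cong₂ (λ e₀ e₁ → e₀ * (ℕtoℚ (suc M C 1) * c ^ℚ M * (d * 1ℚ)) + e₁ * c ^ℚ M) (coeff₀ P) (coeff₁ P) ⟩
    1ℚ * (ℕtoℚ (suc M C 1) * c ^ℚ M * (d * 1ℚ)) + - (½ * n) * c ^ℚ M
      ≡⟨ cong (λ m → 1ℚ * (ℕtoℚ m * c ^ℚ M * (d * 1ℚ)) + - (½ * n) * c ^ℚ M) (nC1≡n (suc M)) ⟩
    1ℚ * (n * c ^ℚ M * (d * 1ℚ)) + - (½ * n) * c ^ℚ M
      ≡⟨ solve 3 (λ n p d → con 1ℚ :* (n :* p :* (d :* con 1ℚ)) :+ (:- (con ½ :* n)) :* p := n :* p :* (d :- con ½))
           refl n (c ^ℚ M) d ⟩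
    n * c ^ℚ M * (d - ½)
      ∎
    where
    open ≡-Reasoning
    E = eulerCoeffs (suc M)
    P = eulerTop (suc M)
    n = ℕtoℚ (suc M)

  eulerAffine₂ : ∀ M → eulerAffine (2 ℕ.+ M) 2 ≡ c ^ℚ M * (ℕtoℚ (2 ℕ.+ M) * ℕtoℚ (1 ℕ.+ M) * ½ * (d * d - d))
  eulerAffine₂ M = begin
    E 0 * affinePow (2 ℕ.+ M) 2 + (E 1 * affinePow (1 ℕ.+ M) 1 + compose M (tail (tail E)) 0)
      ≡⟨ cong₂ (λ p q → E 0 * p + q) (affinePow-coeff 2 M)
           (cong₂ (λ p q → E 1 * p + q) (affinePow-coeff 1 M) (compose-0 M (tail (tail E)))) ⟩
    E 0 * (ℕtoℚ ((2 ℕ.+ M) C 2) * p * (d * (d * 1ℚ))) + (E 1 * (ℕtoℚ ((1 ℕ.+ M) C 1) * p * (d * 1ℚ)) + E 2 * p)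
      ≡⟨ cong₂ (λ e₀ s → e₀ * (ℕtoℚ ((2 ℕ.+ M) C 2) * p * (d * (d * 1ℚ))) + s) (coeff₀ P)
           (cong₂ (λ e₁ e₂ → e₁ * (ℕtoℚ ((1 ℕ.+ M) C 1) * p * (d * 1ℚ)) + e₂ * p) (coeff₁ P) (coeff₂ P)) ⟩
    1ℚ * (ℕtoℚ ((2 ℕ.+ M) C 2) * p * (d * (d * 1ℚ))) + (- (½ * m₂) * (ℕtoℚ ((1 ℕ.+ M) C 1) * p * (d * 1ℚ)) + 0ℚ * p)
      ≡⟨ cong₂ (λ b₂ b₁ → 1ℚ * (b₂ * p * (d * (d * 1ℚ))) + (- (½ * m₂) * (b₁ * p * (d * 1ℚ)) + 0ℚ * p))
           (ℕtoℚ[nC2] (2 ℕ.+ M)) (cong ℕtoℚ (nC1≡n (1 ℕ.+ M))) ⟩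
    1ℚ * (m₂ * (m₂ - 1ℚ) * ½ * p * (d * (d * 1ℚ))) + (- (½ * m₂) * (m₁ * p * (d * 1ℚ)) + 0ℚ * p)
      ≡⟨ cong (λ z → 1ℚ * (z * (z - 1ℚ) * ½ * p * (d * (d * 1ℚ))) + (- (½ * z) * (m₁ * p * (d * 1ℚ)) + 0ℚ * p))
           (ℕtoℚ-+ 1 (1 ℕ.+ M)) ⟩
    1ℚ * ((1ℚ + m₁) * ((1ℚ + m₁) - 1ℚ) * ½ * p * (d * (d * 1ℚ))) + (- (½ * (1ℚ + m₁)) * (m₁ * p * (d * 1ℚ)) + 0ℚ * p)
      ≡⟨ solve 3 (λ m p d → let z = con 1ℚ :+ m in
                   con 1ℚ :* (z :* (z :- con 1ℚ) :* con ½ :* p :* (d :* (d :* con 1ℚ)))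
                     :+ ((:- (con ½ :* z)) :* (m :* p :* (d :* con 1ℚ)) :+ con 0ℚ :* p)
                   := p :* (z :* m :* con ½ :* (d :* d :- d))) refl m₁ p d ⟩
    p * ((1ℚ + m₁) * m₁ * ½ * (d * d - d))
      ≡⟨ cong (λ z → p * (z * m₁ * ½ * (d * d - d))) (sym (ℕtoℚ-+ 1 (1 ℕ.+ M))) ⟩
    p * (m₂ * m₁ * ½ * (d * d - d))
      ∎
    where
    open ≡-Reasoning
    E = eulerCoeffs (2 ℕ.+ M)
    P = eulerTop (2 ℕ.+ M)
    p = c ^ℚ M
    m₁ = ℕtoℚ (1 ℕ.+ M)
    m₂ = ℕtoℚ (2 ℕ.+ M)

  eulerAffine₄ : ∀ M → eulerAffine (5 ℕ.+ M) 4 ≡ c ^ℚ (1 ℕ.+ M) * quartic M d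
  eulerAffine₄ M = begin
    E 0 * affinePow (5 ℕ.+ M) 4 + (E 1 * affinePow (4 ℕ.+ M) 3 + (E 2 * affinePow (3 ℕ.+ M) 2
      + (E 3 * affinePow (2 ℕ.+ M) 1 + (E 4 * affinePow (1 ℕ.+ M) 0 + 0ℚ))))
      ≡⟨ cong₂ _+_ (cong₂ _*_ (coeff₀ P) pow₄) (cong₂ _+_ (cong₂ _*_ (e₁ (coeff₁ P)) pow₃)
           (cong₂ _+_ (cong (_* affinePow (3 ℕ.+ M) 2) (coeff₂ P))
             (cong₂ _+_ (cong₂ _*_ (e₃ (coeff₃ P)) pow₁) (cong (λ e → e * affinePow (1 ℕ.+ M) 0 + 0ℚ) (coeff₄ P))))) ⟩
    1ℚ * (B₄ * p * d ^ℚ 4) + (- (½ * Z) * (B₃ * p * d ^ℚ 3) + (0ℚ * affinePow (3 ℕ.+ M) 2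
      + (B₃′ * ((ℕtoℚ 2 + N) * p * d ^ℚ 1) + (0ℚ * affinePow (1 ℕ.+ M) 0 + 0ℚ))))
      ≡⟨ solve 9 (λ b₄ b₃ b₃′ z n p d w v →
           con 1ℚ :* (b₄ :* p :* (d :* (d :* (d :* (d :* con 1ℚ)))))
             :+ ((:- (con ½ :* z)) :* (b₃ :* p :* (d :* (d :* (d :* con 1ℚ))))
             :+ (con 0ℚ :* w :+ (b₃′ :* ((con (ℕtoℚ 2) :+ n) :* p :* (d :* con 1ℚ)) :+ (con 0ℚ :* v :+ con 0ℚ))))
           := p :* (b₄ :* (d :* (d :* (d :* (d :* con 1ℚ))))
                    :+ (:- (con ½ :* z)) :* b₃ :* (d :* (d :* (d :* con 1ℚ)))
                    :+ b₃′ :* (con (ℕtoℚ 2) :+ n) :* (d :* con 1ℚ)))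
           refl B₄ B₃ B₃′ Z N p d (affinePow (3 ℕ.+ M) 2) (affinePow (1 ℕ.+ M) 0) ⟩
    p * quartic M d
      ∎
    where
    open ≡-Reasoning
    E = eulerCoeffs (5 ℕ.+ M)
    P = eulerTop (5 ℕ.+ M)
    p = c ^ℚ (1 ℕ.+ M)
    N = ℕtoℚ M
    Z = ℕtoℚ 5 + N
    Y = ℕtoℚ 4 + N
    B₄ = Z * (Z - 1ℚ) * (Z - ℕtoℚ 2) * (Z - ℕtoℚ 3) * (+ 1 / 24)
    B₃ = Y * (Y - 1ℚ) * (Y - ℕtoℚ 2) * (+ 1 / 6)
    B₃′ = Z * (Z - 1ℚ) * (Z - ℕtoℚ 2) * (+ 1 / 24)
    ℕtoℚ[k+M] : ∀ k → ℕtoℚ (k ℕ.+ M) ≡ ℕtoℚ k + N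
    ℕtoℚ[k+M] k = ℕtoℚ-+ k M
    e₁ : ∀ {e} → e ≡ - (½ * ℕtoℚ (5 ℕ.+ M)) → e ≡ - (½ * Z)
    e₁ e≡ = trans e≡ (cong (λ z → - (½ * z)) (ℕtoℚ[k+M] 5))
    e₃ : ∀ {e} → e ≡ ℕtoℚ (5 ℕ.+ M) * (ℕtoℚ (5 ℕ.+ M) - 1ℚ) * (ℕtoℚ (5 ℕ.+ M) - ℕtoℚ 2) * (+ 1 / 24) → e ≡ B₃′
    e₃ e≡ = trans e≡ (cong (λ z → z * (z - 1ℚ) * (z - ℕtoℚ 2) * (+ 1 / 24)) (ℕtoℚ[k+M] 5))
    pow₄ : affinePow (5 ℕ.+ M) 4 ≡ B₄ * p * d ^ℚ 4
    pow₄ = trans (affinePow-coeff 4 (1 ℕ.+ M)) (cong (λ b → b * p * d ^ℚ 4)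
      (trans (ℕtoℚ[nC4] (5 ℕ.+ M)) (cong (λ z → z * (z - 1ℚ) * (z - ℕtoℚ 2) * (z - ℕtoℚ 3) * (+ 1 / 24)) (ℕtoℚ[k+M] 5))))
    pow₃ : affinePow (4 ℕ.+ M) 3 ≡ B₃ * p * d ^ℚ 3
    pow₃ = trans (affinePow-coeff 3 (1 ℕ.+ M)) (cong (λ b → b * p * d ^ℚ 3)
      (trans (ℕtoℚ[nC3] (4 ℕ.+ M)) (cong (λ z → z * (z - 1ℚ) * (z - ℕtoℚ 2) * (+ 1 / 6)) (ℕtoℚ[k+M] 4))))
    pow₁ : affinePow (2 ℕ.+ M) 1 ≡ (ℕtoℚ 2 + N) * p * d ^ℚ 1
    pow₁ = trans (affinePow-coeff 1 (1 ℕ.+ M)) (cong (λ b → b * p * d ^ℚ 1)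
      (trans (cong ℕtoℚ (nC1≡n (2 ℕ.+ M))) (ℕtoℚ[k+M] 2)))

u·p+v : ℕ → ℚ → ℚ → Coeffs → Coeffs
u·p+v k u v κ l = u * κ l + shiftBy k (λ j → v * xᴺ j) l

horner-u·p+v : ∀ k u v κ x → horner k (u·p+v k u v κ) x ≡ u * horner k κ x + v
horner-u·p+v k u v κ x = trans (horner-+ k (λ l → u * κ l) (shiftBy k (λ j → v * xᴺ j)) x)
  (cong₂ _+_ (horner-* k u κ x) (horner-constant k v x))

module DicksonAlgebra (M : ℕ) (c a : ℚ) (c≢0 : c ≢ 0ℚ) where

  N Z Y : ℚ
  N = ℕtoℚ M
  Z = ℕtoℚ 5 + N
  Y = ℕtoℚ 4 + N

  coeff₂⇒c²a≡Y/8 : c ^ℚ (3 ℕ.+ M) * (ℕtoℚ (5 ℕ.+ M) * ℕtoℚ (4 ℕ.+ M) * ½ * (½ * ½ - ½)) ≡ c ^ℚ (5 ℕ.+ M) * - (Z * a) →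
    c * c * a ≡ Y * (+ 1 / 8)
  coeff₂⇒c²a≡Y/8 coeff₂≡ = p-q≡0⇒p≡q _ _ (p*q≡0⇒q≡0 (P * Z) _ (*-≢0 (^-≢0 (3 ℕ.+ M) c≢0) (ℕtoℚ-suc+≢0 4 M)) (begin
    P * Z * (c * c * a - Y * (+ 1 / 8))
      ≡⟨ solve 5 (λ P Z Y c a → P :* Z :* (c :* c :* a :- Y :* con (+ 1 / 8))
                   := P :* (Z :* Y :* con ½ :* (con ½ :* con ½ :- con ½)) :- c :* (c :* P) :* (:- (Z :* a))) refl P Z Y c a ⟩
    P * (Z * Y * ½ * (½ * ½ - ½)) - c * (c * P) * - (Z * a)
      ≡⟨ cong₂ (λ z y → P * (z * y * ½ * (½ * ½ - ½)) - c * (c * P) * - (Z * a)) (sym (ℕtoℚ-+ 5 M)) (sym (ℕtoℚ-+ 4 M)) ⟩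
    P * (ℕtoℚ (5 ℕ.+ M) * ℕtoℚ (4 ℕ.+ M) * ½ * (½ * ½ - ½)) - c * (c * P) * - (Z * a)
      ≡⟨ p≡q⇒p-q≡0 coeff₂≡ ⟩
    0ℚ
      ∎))
    where
    open ≡-Reasoning
    P = c ^ℚ (3 ℕ.+ M)

  quartic-½ : quartic M ½ - (Y * (+ 1 / 8)) * (Y * (+ 1 / 8)) * (Z * (ℕtoℚ 3 + N - 1ℚ) * ½)
            ≡ (+ 1 / 384) * (Z * Y * (ℕtoℚ 2 + N) * (ℕtoℚ 3 + ℕtoℚ 2 * N))
  quartic-½ = solve 1 (λ N →
    let Z = con (ℕtoℚ 5) :+ N
        Y = con (ℕtoℚ 4) :+ N
        d = con ½
    in Z :* (Z :- con 1ℚ) :* (Z :- con (ℕtoℚ 2)) :* (Z :- con (ℕtoℚ 3)) :* con (+ 1 / 24) :* (d :* (d :* (d :* (d :* con 1ℚ))))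
         :+ (:- (con ½ :* Z)) :* (Y :* (Y :- con 1ℚ) :* (Y :- con (ℕtoℚ 2)) :* con (+ 1 / 6)) :* (d :* (d :* (d :* con 1ℚ)))
         :+ Z :* (Z :- con 1ℚ) :* (Z :- con (ℕtoℚ 2)) :* con (+ 1 / 24) :* (con (ℕtoℚ 2) :+ N) :* (d :* con 1ℚ)
         :- (Y :* con (+ 1 / 8)) :* (Y :* con (+ 1 / 8)) :* (Z :* (con (ℕtoℚ 3) :+ N :- con 1ℚ) :* con ½)
       := con (+ 1 / 384) :* (Z :* Y :* (con (ℕtoℚ 2) :+ N) :* (con (ℕtoℚ 3) :+ con (ℕtoℚ 2) :* N))) refl N

  quartic-mismatch : c * c * a ≡ Y * (+ 1 / 8) →
    c ^ℚ (1 ℕ.+ M) * quartic M ½ ≢ c ^ℚ (5 ℕ.+ M) * (Z * (ℕtoℚ 3 + N - 1ℚ) * ½ * (a * a))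
  quartic-mismatch c²a≡ coeff₄≡ = *-≢0 1/384≢0 (*-≢0 (*-≢0 (*-≢0 (ℕtoℚ-suc+≢0 4 M) (ℕtoℚ-suc+≢0 3 M)) (ℕtoℚ-suc+≢0 1 M)) 3+2N≢0)
    (trans (sym quartic-½) (subst (λ w → quartic M ½ - w * w * T ≡ 0ℚ) c²a≡ difference≡0))
    where
    P = c ^ℚ (1 ℕ.+ M)
    T = Z * (ℕtoℚ 3 + N - 1ℚ) * ½
    difference≡0 : quartic M ½ - (c * c * a) * (c * c * a) * T ≡ 0ℚ
    difference≡0 = p*q≡0⇒q≡0 P _ (^-≢0 (1 ℕ.+ M) c≢0) (trans
      (solve 5 (λ P q c a T → P :* (q :- (c :* c :* a) :* (c :* c :* a) :* T) := P :* q :- c :* (c :* (c :* (c :* P))) :* (T :* (a :* a)))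
        refl P (quartic M ½) c a T)
      (p≡q⇒p-q≡0 coeff₄≡))
    3+2N≢0 : ℕtoℚ 3 + ℕtoℚ 2 * N ≢ 0ℚ
    3+2N≢0 e = ℕtoℚ-suc≢0 (2 ℕ.+ 2 ℕ.* M) (trans (trans (ℕtoℚ-+ 3 (2 ℕ.* M)) (cong (λ t → ℕtoℚ 3 + t) (ℕtoℚ-* 2 M))) e)
    1/384≢0 : + 1 / 384 ≢ 0ℚ
    1/384≢0 ()

module Matching (c d u v : ℚ) (c≢0 : c ≢ 0ℚ) (u≢0 : u ≢ 0ℚ) where
  open EulerAffine c d

  Matches : ℕ → ℕ → Coeffs → Set
  Matches n k κ = ∀ x → euler n (c * x + d) ≡ u * horner k κ x + v

  same-horner : ∀ n k κ → Matches n k κ → ∀ x → horner n (eulerAffine n) x ≡ horner k (u·p+v k u v κ) x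
  same-horner n k κ E≡up+v x = trans (sym (euler-affine n x)) (trans (E≡up+v x) (sym (horner-u·p+v k u v κ x)))

  degree-match : ∀ n k κ → κ 0 ≡ 1ℚ → Matches n (suc k) κ → n ≡ suc k
  degree-match n k κ κ₀≡1 E≡up+v = horner-degree-unique n (suc k) (eulerAffine n) (u·p+v (suc k) u v κ)
    (same-horner n (suc k) κ E≡up+v)
    (λ e → ^-≢0 n c≢0 (trans (sym (eulerAffine₀ n)) e))
    (λ e → u≢0 (trans (sym top≡u) e))
    where
    top≡u : u * κ 0 + 0ℚ ≡ u
    top≡u = trans (cong (λ t → u * t + 0ℚ) κ₀≡1) (solve 1 (λ u → u :* con 1ℚ :+ con 0ℚ := u) refl u)

  coeff-match : ∀ k κ → Matches k k κ → ∀ l → l < k → eulerAffine k l ≡ u * κ l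
  coeff-match k κ E≡up+v l l<k = begin
    eulerAffine k l                                ≡⟨ horner-injective k _ _ (same-horner k k κ E≡up+v) l (ℕₚ.<⇒≤ l<k) ⟩
    u * κ l + shiftBy k (λ j → v * xᴺ j) l         ≡⟨ cong (λ s → u * κ l + s) (shiftBy-< k _ l l<k) ⟩
    u * κ l + 0ℚ                                   ≡⟨ ℚₚ.+-identityʳ (u * κ l) ⟩
    u * κ l                                        ∎
    where open ≡-Reasoning

  top₁≡0⇒d≡½ : ∀ M → eulerAffine (suc M) 1 ≡ 0ℚ → d ≡ ½
  top₁≡0⇒d≡½ M top₁≡0 = p-q≡0⇒p≡q d ½ (p*q≡0⇒q≡0 _ (d - ½) (*-≢0 (ℕtoℚ-suc≢0 M) (^-≢0 M c≢0))
    (trans (sym (eulerAffine₁ M)) top₁≡0))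

  power-mismatch : ∀ M → ¬ Matches (3 ℕ.+ M) (3 ℕ.+ M) xᴺ
  power-mismatch M E≡ = *-≢0 (^-≢0 (1 ℕ.+ M) c≢0) (*-≢0 (*-≢0 (*-≢0 (ℕtoℚ-suc≢0 (2 ℕ.+ M)) (ℕtoℚ-suc≢0 (1 ℕ.+ M))) λ ()) ½²-½≢0)
    (subst (λ d → c ^ℚ (1 ℕ.+ M) * (ℕtoℚ (3 ℕ.+ M) * ℕtoℚ (2 ℕ.+ M) * ½ * (d * d - d)) ≡ 0ℚ)
           (top₁≡0⇒d≡½ (2 ℕ.+ M) (lower≡0 0 (s≤s (s≤s z≤n))))
           (trans (sym (eulerAffine₂ (1 ℕ.+ M))) (lower≡0 1 (s≤s (s≤s (s≤s z≤n))))))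
    where
    ½²-½≢0 : ½ * ½ - ½ ≢ 0ℚ
    ½²-½≢0 ()
    lower≡0 : ∀ l → suc l < 3 ℕ.+ M → eulerAffine (3 ℕ.+ M) (suc l) ≡ 0ℚ
    lower≡0 l l<q = trans (coeff-match (3 ℕ.+ M) xᴺ E≡ (suc l) l<q) (ℚₚ.*-zeroʳ u)

  euler-affine≢power : ∀ n q → 3 ≤ q → ¬ (∀ x → euler n (c * x + d) ≡ u * (x ^ℚ q) + v)
  euler-affine≢power n q@(suc (suc (suc M))) (s≤s (s≤s (s≤s _))) E≡ux^q+v =
    power-mismatch M (subst (λ n → Matches n q xᴺ) (degree-match n (2 ℕ.+ M) xᴺ refl E≡) E≡)
    where
    E≡ : Matches n q xᴺ
    E≡ x = trans (E≡ux^q+v x) (cong (λ p → u * p + v) (sym (horner-xᴺ q x)))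

  dickson-mismatch : ∀ M a → ¬ Matches (5 ℕ.+ M) (5 ℕ.+ M) (dicksonCoeffs (5 ℕ.+ M) a)
  dickson-mismatch M a E≡ = quartic-mismatch c²a≡Y/8 coeff₄
    where
    open DicksonTop M a using (dickson₀; dickson₁; dickson₂; dickson₄)
    open DicksonAlgebra M c a c≢0
    k = 5 ℕ.+ M
    coeff : ∀ l → l < k → eulerAffine k l ≡ u * dicksonCoeffs k a l
    coeff = coeff-match k (dicksonCoeffs k a) E≡
    c^k≡u : c ^ℚ k ≡ u
    c^k≡u = trans (sym (eulerAffine₀ k)) (trans (coeff 0 (s≤s z≤n)) (trans (cong (u *_) dickson₀) (ℚₚ.*-identityʳ u)))
    d≡½ : d ≡ ½
    d≡½ = top₁≡0⇒d≡½ (4 ℕ.+ M) (trans (coeff 1 (s≤s (s≤s z≤n))) (trans (cong (u *_) dickson₁) (ℚₚ.*-zeroʳ u)))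
    coeff₂ : c ^ℚ (3 ℕ.+ M) * (ℕtoℚ (5 ℕ.+ M) * ℕtoℚ (4 ℕ.+ M) * ½ * (½ * ½ - ½)) ≡ c ^ℚ k * - (Z * a)
    coeff₂ = subst₂ (λ d u → c ^ℚ (3 ℕ.+ M) * (ℕtoℚ (5 ℕ.+ M) * ℕtoℚ (4 ℕ.+ M) * ½ * (d * d - d)) ≡ u * - (Z * a))
      d≡½ (sym c^k≡u) (trans (sym (eulerAffine₂ (3 ℕ.+ M))) (trans (coeff 2 (s≤s (s≤s (s≤s z≤n)))) (cong (u *_) dickson₂)))
    c²a≡Y/8 : c * c * a ≡ Y * (+ 1 / 8)
    c²a≡Y/8 = coeff₂⇒c²a≡Y/8 coeff₂
    coeff₄ : c ^ℚ (1 ℕ.+ M) * quartic M ½ ≡ c ^ℚ k * (Z * (ℕtoℚ 3 + N - 1ℚ) * ½ * (a * a))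
    coeff₄ = subst₂ (λ d u → c ^ℚ (1 ℕ.+ M) * quartic M d ≡ u * (Z * (ℕtoℚ 3 + N - 1ℚ) * ½ * (a * a)))
      d≡½ (sym c^k≡u) (trans (sym (eulerAffine₄ M)) (trans (coeff 4 (s≤s (s≤s (s≤s (s≤s (s≤s z≤n)))))) (cong (u *_) dickson₄)))

  euler-affine≢dickson : ∀ n k → 4 < k → ∀ a → ¬ (∀ x → euler n (c * x + d) ≡ u * dickson k x a + v)
  euler-affine≢dickson n k@(suc (suc (suc (suc (suc M))))) (s≤s (s≤s (s≤s (s≤s (s≤s _))))) a E≡uD+v =
    dickson-mismatch M a (subst (λ n → Matches n k D) (degree-match n (4 ℕ.+ M) D (DicksonTop.dickson₀ M a) E≡) E≡)
    where
    D = dicksonCoeffs k a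
    E≡ : Matches n k D
    E≡ x = trans (E≡uD+v x) (cong (λ p → u * p + v) (sym (horner-dickson k a x)))

lemma3p5 : (n : ℕ) → 1 ≤ n → (c d u v : ℚ) → c ≢ 0ℚ → u ≢ 0ℚ →
    (¬ Σ ℕ (λ q → 3 ≤ q × (∀ (x : ℚ) → euler n (c * x + d) ≡ u * (x ^ℚ q) + v)))
    × (¬ Σ ℕ (λ k → 4 < k × Σ ℚ (λ a → a ≢ 0ℚ × (∀ (x : ℚ) → euler n (c * x + d) ≡ u * dickson k x a + v))))
lemma3p5 n _ c d u v c≢0 u≢0 =
  (λ (q , 3≤q , E≡ux^q+v) → euler-affine≢power n q 3≤q E≡ux^q+v) ,
  (λ (k , 4<k , a , _ , E≡uD+v) → euler-affine≢dickson n k 4<k a E≡uD+v)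
  where open Matching c d u v c≢0 u≢0
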